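{- Let $n\in\mathbb N$ with $n\ge 5$ and let $J_n(1)$ be the finite Jaco graph on vertices $v_1,\dots,v_n$. Let $V^*=\{v_i : 3\le i\le n-1\}$ and let $\langle V^*\rangle$ denote the subgraph of the underlying undirected graph of $J_n(1)$ induced by $V^*$. Then the competition graph of $J_n(1)$ is $$C(J_n(1)) = \Big(\langle V^*\rangle - \{v_iv_{m_i} : m_i = i + d^+_{J_n(1)}(v_i),\ 3\le i\le n-2\}\Big) \cup \{v_1,v_2,v_n\},$$ i.e. $C(J_n(1))$ is obtained from $\langle V^*\rangle$ by deleting the edges $v_iv_{m_i}$ ($3\le i\le n-2$, $m_i=i+d^+_{J_n(1)}(v_i)$) and adding $v_1,v_2,v_n$ as isolated vertices.
   Context: The infinite Jaco graph $J_\infty(1)$ is the directed graph with vertex set $\{v_i : i\in\mathbb N\}$ in which, for $i<j$, the arc $(v_i,v_j)$ is present if and only if $2i - d^-(v_i)\ge j$, where $d^-(v_i)$ is the in-degree of $v_i$ (this is well defined recursively, since the in-degree of $v_i$ depends only on arcs from vertices $v_k$ with $k<i$); there are no arcs $(v_j,v_i)$ with $j>i$. The finite Jaco graph $J_n(1)$ is the subdigraph of $J_\infty(1)$ induced by $v_1,\dots,v_n$ (all vertices $v_t$, $t>n$, and arcs incident to them are removed), with this fixed orientation. $d^+_{J_n(1)}(v)$ denotes the out-degree of $v$ in $J_n(1)$. For a directed graph $D$, its competition graph $C(D)$ is the simple undirected graph with vertex set $V(D)$ in which distinct $v,y$ are adjacent if and only if there is a vertex $w$ such that both arcs $(v,w)$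 and $(y,w)$ are in $D$. -}

module Defs where

open import Data.Nat using (ℕ; zero; suc; _+_; _*_; _∸_; _≤_; _<_; _≤ᵇ_)
open import Data.Bool using (Bool; true; false; if_then_else_)
open import Data.Product using (_×_; ∃-syntax)
open import Data.Sum using (_⊎_)
open import Relation.Binary.PropositionalEquality using (_≡_)
open import Relation.Nullary using (¬_)

count : ℕ → (ℕ → Bool) → ℕ
count zero    p = 0
count (suc m) p = (if p (suc m) then 1 else 0) + count m p

-- indegTable n i = d⁻(v_i) in J_∞(1), valid for all i ≤ n (values for i > n are junk).
-- d⁻(v_1) = 0 and d⁻(v_{n+1}) = #{ k ∈ 1..n : 2k - d⁻(v_k) ≥ n+1 }.
indegTable : ℕ → ℕ → ℕ
indegTable zero    i = 0
indegTable (suc n) i =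
  if i ≤ᵇ n then indegTable n i
  else count n (λ k → suc n ≤ᵇ (2 * k ∸ indegTable n k))

indeg : ℕ → ℕ
indeg i = indegTable i i

arcᵇ : ℕ → ℕ → Bool
arcᵇ i j = if (1 ≤ᵇ i) then (if (suc i ≤ᵇ j) then (j ≤ᵇ (2 * i ∸ indeg i)) else false) else false

Arc : ℕ → ℕ → ℕ → Set
Arc n i j = 1 ≤ i × i ≤ n × 1 ≤ j × j ≤ n × i < j × j ≤ 2 * i ∸ indeg i

outdeg : ℕ → ℕ → ℕ
outdeg n i = count n (λ j → arcᵇ i j)

CompAdj : ℕ → ℕ → ℕ → Set
CompAdj n u v = ¬ (u ≡ v) × ∃[ w ] (Arc n u w × Arc n v w)

UAdj : ℕ → ℕ → ℕ → Set
UAdj n u v = Arc n u v ⊎ Arc n v u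

InVStar : ℕ → ℕ → Set
InVStar n i = 3 ≤ i × i ≤ n ∸ 1

mIdx : ℕ → ℕ → ℕ
mIdx n i = i + outdeg n i

Deleted : ℕ → ℕ → ℕ → Set
Deleted n u v = ∃[ i ] (3 ≤ i × i ≤ n ∸ 2 ×
  ((u ≡ i × v ≡ mIdx n i) ⊎ (u ≡ mIdx n i × v ≡ i)))

-- Adjacency of (⟨V*⟩ − deleted edges) ∪ {v_1, v_2, v_n} (the added vertices are isolated).
RHSAdj : ℕ → ℕ → ℕ → Set
RHSAdj n u v = InVStar n u × InVStar n v × UAdj n u v × ¬ Deleted n u v

-- Write reach i = 2i − d⁻(v_i), so that v_i → v_j is an arc of J_∞(1) exactly when i < j ≤ reach i.
-- Since d⁻(v_i) ≤ i − 1, every v_i has an arc to v_{i+1}, and the out-neighbourhood of v_i in J_n(1)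
-- is the interval (i, n ⊓ reach i]; hence m_i = n ⊓ reach i.  For u < v, a common out-neighbour must
-- exceed v and lie in that interval, and v_{v+1} is one as soon as the interval reaches past v.
-- So v_u and v_v compete iff v < m_u, which is precisely adjacency in ⟨V*⟩ minus the edge v_u v_{m_u}.
module Submission where

open import Defs
open import Data.Nat using (ℕ; zero; suc; _+_; _*_; _∸_; _≤_; _<_; _≤ᵇ_; _⊓_; z≤n; s≤s)
open import Data.Nat.Properties
open import Data.Bool using (true; false; if_then_else_)
open import Data.Product using (_,_)
open import Data.Sum using (inj₁; inj₂)
open import Data.Empty using (⊥-elim)
open import Function.Bundles using (_⇔_; mk⇔)
open import Function.Properties.Equivalence using () renaming (sym to ⇔-sym; trans to ⇔-trans)
open import Relation.Binary using (tri<; tri≈; tri>)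
open import Relation.Binary.PropositionalEquality using (_≡_; refl; sym; trans; cong; subst; module ≡-Reasoning)
open import Relation.Nullary using (¬_)
open import Relation.Nullary.Reflects using (ofʸ; ofⁿ)

count-≤ : ∀ m p → count m p ≤ m
count-≤ zero    p = z≤n
count-≤ (suc m) p with p (suc m)
... | true  = s≤s (count-≤ m p)
... | false = m≤n⇒m≤1+n (count-≤ m p)

count-interval : ∀ i G m →
  count m (λ j → if suc i ≤ᵇ j then j ≤ᵇ G else false) ≡ m ⊓ G ∸ i
count-interval i G zero = sym (0∸n≡0 i)
count-interval i G (suc m)
  with suc m ≤ᵇ G | ≤ᵇ-reflects-≤ (suc m) G | suc i ≤ᵇ suc m | ≤ᵇ-reflects-≤ (suc i) (suc m)
... | true  | ofʸ m<G | true  | ofʸ i<1+m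
  rewrite count-interval i G m | m≤n⇒m⊓n≡m m<G | m≤n⇒m⊓n≡m (<⇒≤ m<G) = sym (+-∸-assoc 1 (≤-pred i<1+m))
... | true  | ofʸ m<G | false | ofⁿ i≮1+m
  rewrite count-interval i G m | m≤n⇒m⊓n≡m m<G | m≤n⇒m⊓n≡m (<⇒≤ m<G)
        | m≤n⇒m∸n≡0 (≤-pred (≰⇒> i≮1+m)) | m≤n⇒m∸n≡0 (<⇒≤ (≤-pred (≰⇒> i≮1+m))) = refl
... | false | ofⁿ m≮G | true  | _
  rewrite count-interval i G m | m≥n⇒m⊓n≡n (≤-pred (≰⇒> m≮G)) | m≥n⇒m⊓n≡n (<⇒≤ (≰⇒> m≮G)) = refl
... | false | ofⁿ m≮G | false | _
  rewrite count-interval i G m | m≥n⇒m⊓n≡n (≤-pred (≰⇒> m≮G)) | m≥n⇒m⊓n≡n (<⇒≤ (≰⇒> m≮G)) = refl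

indeg-suc-≤ : ∀ k → indeg (suc k) ≤ k
indeg-suc-≤ k with suc k ≤ᵇ k | ≤ᵇ-reflects-≤ (suc k) k
... | true  | ofʸ k<k = ⊥-elim (<-irrefl refl k<k)
... | false | _       = count-≤ k _

reach : ℕ → ℕ
reach i = 2 * i ∸ indeg i

<reach : ∀ {i} → 1 ≤ i → i < reach i
<reach {suc k} _ = begin
  suc (suc k)                         ≡⟨ m+n∸n≡m (suc (suc k)) k ⟨
  suc (suc k) + k ∸ k                 ≤⟨ ∸-monoʳ-≤ (suc (suc k) + k) (indeg-suc-≤ k) ⟩
  suc (suc k) + k ∸ indeg (suc k)     ≡⟨ cong (_∸ indeg (suc k)) (+-suc (suc k) k) ⟨
  suc k + suc k ∸ indeg (suc k)       ≡⟨ cong (λ x → suc k + x ∸ indeg (suc k)) (+-identityʳ (suc k)) ⟨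
  reach (suc k)                       ∎
  where open ≤-Reasoning

-- reach 1 = 2 and reach 2 = 3, so v_1 and v_2 have no out-neighbour beyond v_{i+1}.
suc<reach⇒3≤ : ∀ u → suc u < reach u → 3 ≤ u
suc<reach⇒3≤ 0 ()
suc<reach⇒3≤ 1 (s≤s (s≤s ()))
suc<reach⇒3≤ 2 (s≤s (s≤s (s≤s ())))
suc<reach⇒3≤ (suc (suc (suc u))) _ = s≤s (s≤s (s≤s z≤n))

outdeg≡ : ∀ n {i} → 1 ≤ i → outdeg n i ≡ n ⊓ reach i ∸ i
outdeg≡ n {suc k} _ = count-interval (suc k) (reach (suc k)) n

mIdx≡ : ∀ n {i} → 1 ≤ i → i ≤ n → mIdx n i ≡ n ⊓ reach i
mIdx≡ n {i} 1≤i i≤n = begin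
  i + outdeg n i          ≡⟨ cong (i +_) (outdeg≡ n 1≤i) ⟩
  i + (n ⊓ reach i ∸ i)   ≡⟨ m+[n∸m]≡n (⊓-glb i≤n (<⇒≤ (<reach 1≤i))) ⟩
  n ⊓ reach i             ∎
  where open ≡-Reasoning

CompAdj⇔<⊓reach : ∀ {n u v} → 1 ≤ u → u < v → CompAdj n u v ⇔ v < n ⊓ reach u
CompAdj⇔<⊓reach {n} {u} {v} 1≤u u<v = mk⇔ to from
  where
  to : CompAdj n u v → v < n ⊓ reach u
  to (_ , w , (_ , _ , _ , w≤n , _ , w≤reach-u) , (_ , _ , _ , _ , v<w , _)) =
    <-≤-trans v<w (⊓-glb w≤n w≤reach-u)

  from : v < n ⊓ reach u → CompAdj n u v
  from v<m = (λ u≡v → <-irrefl u≡v u<v) , suc v ,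
    (1≤u , <⇒≤ (<-trans u<v v<n) , s≤s z≤n , v<n , <-trans u<v (n<1+n v) , v<reach-u) ,
    (1≤v , <⇒≤ v<n , s≤s z≤n , v<n , n<1+n v , <reach 1≤v)
    where
    v<n : v < n
    v<n = m<n⊓o⇒m<n n (reach u) v<m
    v<reach-u : v < reach u
    v<reach-u = m<n⊓o⇒m<o n (reach u) v<m
    1≤v : 1 ≤ v
    1≤v = ≤-trans 1≤u (<⇒≤ u<v)

RHSAdj⇔<⊓reach : ∀ {n u v} → 1 ≤ u → u < v → RHSAdj n u v ⇔ v < n ⊓ reach u
RHSAdj⇔<⊓reach {n} {u} {v} 1≤u u<v = mk⇔ to from
  where
  to : RHSAdj n u v → v < n ⊓ reach u
  to (_ , _ , inj₂ (_ , _ , _ , _ , v<u , _) , _) = ⊥-elim (<-asym u<v v<u)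
  to ((3≤u , _) , (_ , v≤n-1) , inj₁ (_ , u≤n , _ , v≤n , _ , v≤reach-u) , ¬deleted)
    with m≤n⇒m<n∨m≡n (⊓-glb v≤n v≤reach-u)
  ... | inj₁ v<m = v<m
  ... | inj₂ v≡m = ⊥-elim (¬deleted (u , 3≤u , u≤n-2 , inj₁ (refl , v≡mIdx)))
    where
    u≤n-2 : u ≤ n ∸ 2
    u≤n-2 = subst (u ≤_) (pred[m∸n]≡m∸[1+n] n 1) (<⇒≤pred (<-≤-trans u<v v≤n-1))
    v≡mIdx : v ≡ mIdx n u
    v≡mIdx = trans v≡m (sym (mIdx≡ n 1≤u u≤n))

  from : v < n ⊓ reach u → RHSAdj n u v
  from v<m = (3≤u , <⇒≤pred u<n) , (≤-trans 3≤u (<⇒≤ u<v) , <⇒≤pred v<n) ,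
    inj₁ (1≤u , <⇒≤ u<n , ≤-trans 1≤u (<⇒≤ u<v) , <⇒≤ v<n , u<v , <⇒≤ v<reach-u) , ¬deleted
    where
    v<n : v < n
    v<n = m<n⊓o⇒m<n n (reach u) v<m
    v<reach-u : v < reach u
    v<reach-u = m<n⊓o⇒m<o n (reach u) v<m
    u<n : u < n
    u<n = <-trans u<v v<n
    3≤u : 3 ≤ u
    3≤u = suc<reach⇒3≤ u (≤-<-trans u<v v<reach-u)
    ¬deleted : ¬ Deleted n u v
    ¬deleted (_ , _ , _ , inj₁ (refl , refl)) = <-irrefl (mIdx≡ n 1≤u (<⇒≤ u<n)) v<m
    ¬deleted (_ , _ , _ , inj₂ (refl , refl)) = <⇒≱ u<v (m≤m+n v (outdeg n v))

Deleted-sym : ∀ {n u v} → Deleted n u v → Deleted n v u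
Deleted-sym (i , 3≤i , i≤n-2 , inj₁ (u≡i , v≡m)) = i , 3≤i , i≤n-2 , inj₂ (v≡m , u≡i)
Deleted-sym (i , 3≤i , i≤n-2 , inj₂ (u≡m , v≡i)) = i , 3≤i , i≤n-2 , inj₁ (v≡i , u≡m)

RHSAdj-sym : ∀ {n u v} → RHSAdj n u v → RHSAdj n v u
RHSAdj-sym {n} (u∈V* , v∈V* , inj₁ arc , ¬deleted) = v∈V* , u∈V* , inj₂ arc , λ d → ¬deleted (Deleted-sym {n} d)
RHSAdj-sym {n} (u∈V* , v∈V* , inj₂ arc , ¬deleted) = v∈V* , u∈V* , inj₁ arc , λ d → ¬deleted (Deleted-sym {n} d)

CompAdj-sym : ∀ {n u v} → CompAdj n u v → CompAdj n v u
CompAdj-sym (u≢v , w , uw , vw) = (λ v≡u → u≢v (sym v≡u)) , w , vw , uw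

UAdj-irrefl : ∀ {n u} → ¬ UAdj n u u
UAdj-irrefl (inj₁ (_ , _ , _ , _ , u<u , _)) = <-irrefl refl u<u
UAdj-irrefl (inj₂ (_ , _ , _ , _ , u<u , _)) = <-irrefl refl u<u

CompAdj⇔RHSAdj : ∀ {n u v} → 1 ≤ u → u < v → CompAdj n u v ⇔ RHSAdj n u v
CompAdj⇔RHSAdj 1≤u u<v = ⇔-trans (CompAdj⇔<⊓reach 1≤u u<v) (⇔-sym (RHSAdj⇔<⊓reach 1≤u u<v))

theorem1p1 : (n : ℕ) → 5 ≤ n → (u v : ℕ) → 1 ≤ u → u ≤ n → 1 ≤ v → v ≤ n →
    CompAdj n u v ⇔ RHSAdj n u v
theorem1p1 n _ u v 1≤u _ 1≤v _ with <-cmp u v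
... | tri< u<v _ _ = CompAdj⇔RHSAdj 1≤u u<v
... | tri≈ _ refl _ = mk⇔ (λ (u≢u , _) → ⊥-elim (u≢u refl)) (λ (_ , _ , adj , _) → ⊥-elim (UAdj-irrefl adj))
... | tri> _ _ v<u =
  ⇔-trans (mk⇔ CompAdj-sym CompAdj-sym) (⇔-trans (CompAdj⇔RHSAdj 1≤v v<u) (mk⇔ (RHSAdj-sym {n}) (RHSAdj-sym {n})))
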